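{- Let $d,r\geq1$ and let $A\in\mathcal{A}(r\Delta_{1,d})$, and let $\mathrm{comp}(A)=(c_1,\dots,c_{d+1})$. List the $d$ marks of the decorated matrix $\widetilde M_{\mathcal{I}_A}$ in reading order (columns from left to right, and within a column from top to bottom) as $m_1,\dots,m_d$, and let $b_t$ be the column of $m_t$. Then: (1) $c_1=b_1-1$; (2) for $2\leq t\leq d$, $c_t=b_t-b_{t-1}-1$ if $m_t$ lies strictly higher (between rows with smaller indices) than $m_{t-1}$, and $c_t=b_t-b_{t-1}$ if $m_t$ lies lower than $m_{t-1}$; (3) $c_{d+1}=r-b_d$.
   Context: $r\Delta_{1,d}=\{x\in\mathbb{R}^{d+1}: x_k\geq 0,\ \sum_kx_k=r\}$; its alcoves are the maximal simplices of the subdivision by the hyperplanes $x_{a+1}+\dots+x_b=m$ ($0\leq a<b\leq d+1$, $m\in\mathbb{Z}$), identified with vertex sets $A=\{\vec a_1,\dots,\vec a_{d+1}\}\subset\mathbb{N}^{d+1}$. For a finite set $V\subset\mathbb{N}^{d+1}$, $\mathrm{comp}(V)=(c_1,\dots,c_{d+1})$ with $c_k=\min_{\vec v\in V}v_k$. For $\vec a\in\mathbb{N}^{d+1}$ with coordinate sum $r$, $I_{\vec a}$ is the $r$-multiset of $[d+1]$ with $a_t$ copies of $t$, written $I=\{I_1\leq\dots\leq I_r\}$. Vertices are ordered so that the collection is sorted: $I_{11}\leq I_{21}\leq\dots\leq I_{(d+1)1}\leq I_{12}\leq\dots\leq I_{(d+1)r}$. $\widetilde M_{\mathcal{I}_A}$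 is the $(d+1)\times r$ grid with row $a$ equal to $I_{\vec a_a}$, where the edge between cells $(a,b)$ and $(a+1,b)$ is marked iff $I_{ab}<I_{(a+1)b}$. It is known that there is exactly one mark between rows $i$ and $i+1$ for each $1\leq i\leq d$ and no other marks, so there are exactly $d$ marks, each in a different pair of consecutive rows. -}

module Defs where

open import Data.Nat using (ℕ; zero; suc; _+_; _≤_; _<_; _⊓_; _<?_)
open import Data.Fin using (Fin; toℕ; inject₁)
open import Data.List using (List; []; _∷_; concatMap; replicate; upTo; allFin; map; foldr; filter)
open import Data.Product using (_×_; _,_)
open import Data.Nat.ListAction using (sum)
open import Relation.Binary.PropositionalEquality using (_≡_)
open import Relation.Nullary using (does)
open import Data.Bool using (if_then_else_)

-- A candidate alcove vertex set is given as an ordered family of d+1 points: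
-- A a k = k-th coordinate (0-based) of the a-th vertex (0-based).
Pt : ℕ → Set
Pt d = Fin (suc d) → ℕ

Verts : ℕ → Set
Verts d = Fin (suc d) → Pt d

-- sum of the coordinates of x with 0-based index k, p ≤ k < q
-- (this is x_{p+1} + … + x_q in the paper's 1-based notation)
intervalSum : ∀ {d} → Pt d → ℕ → ℕ → ℕ
intervalSum {d} x p q =
  sum (map x (filter (λ k → p Data.Nat.≤? toℕ k) (filter (λ k → toℕ k <? q) (allFin (suc d)))))

coordSum : ∀ {d} → Pt d → ℕ
coordSum {d} x = sum (map x (allFin (suc d)))

-- A is (an ordering of) the vertex set of an alcove of rΔ_{1,d}:
-- d+1 distinct lattice points of rΔ_{1,d} such that, for every hyperplane
-- family x_{p+1}+…+x_q = m (0 ≤ p < q ≤ d+1), all points of A lie in one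
-- closed slab m ≤ x_{p+1}+…+x_q ≤ m+1 (i.e. conv A lies in the closure of one
-- cell of the subdivision and, having d+1 distinct lattice vertices, is a
-- maximal simplex of it).
record IsAlcove (d r : ℕ) (A : Verts d) : Set where
  field
    onSimplex : ∀ a → coordSum (A a) ≡ r
    distinct  : ∀ a a' → (∀ k → A a k ≡ A a' k) → a ≡ a'
    slab      : ∀ p q → p < q → q ≤ suc d → ∀ a a' →
                intervalSum (A a) p q ≤ intervalSum (A a') p q + 1

-- I_x as a weakly increasing list: x_t copies of t (values 0-based: t = 0..d)
multiset : ∀ {d} → Pt d → List ℕ
multiset {d} x = concatMap (λ t → replicate (x t) (toℕ t)) (allFin (suc d))

-- j-th entry (0-based) of a list, with default 0 outside the range
nth : List ℕ → ℕ → ℕ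
nth []       _       = 0
nth (x ∷ xs) zero    = x
nth (x ∷ xs) (suc j) = nth xs j

-- entry of the grid M̃: row a (0-based), column j (0-based)
entry : ∀ {d} → Verts d → Fin (suc d) → ℕ → ℕ
entry A a j = nth (multiset (A a)) j

-- the vertices are ordered so that the column-major reading of the grid is
-- weakly increasing (I_{11} ≤ I_{21} ≤ … ≤ I_{(d+1)1} ≤ I_{12} ≤ …)
Sorted : (d r : ℕ) → Verts d → Set
Sorted d r A = ∀ (a a' : Fin (suc d)) (j j' : ℕ) → j' < r →
  (j < j' Data.Sum.⊎ (j ≡ j' × toℕ a ≤ toℕ a')) → entry A a j ≤ entry A a' j'
  where import Data.Sum

-- A mark is a pair (j , i): j = 0-based column, i : Fin d meaning the
-- edge between rows i and i+1 (0-based), marked iff entry(i,j) < entry(i+1,j).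
marks : (d r : ℕ) → Verts d → List (ℕ × Fin d)
marks d r A =
  concatMap (λ j → concatMap (λ i →
      if does (entry A (inject₁ i) j <? entry A (Data.Fin.suc i) j)
      then (j , i) ∷ [] else [])
    (allFin d))
  (upTo r)

comp : ∀ {d} → Verts d → Pt d
comp {d} A k = foldr (λ a m → A a k ⊓ m) (A Data.Fin.zero k) (allFin (suc d))

{-# OPTIONS --safe #-}
-- Row a of the matrix is the multiset of the composition A a, so its entry in column j is at most t
-- exactly when j < P_a(t) = (A a)_0 + … + (A a)_t.  Because the matrix is sorted column by column,
-- P_{a'}(t) ≤ P_a(t) ≤ P_{a'}(t) + 1 for rows a ≤ a'; hence for each t the prefix sums drop by one
-- between at most one pair of adjacent rows, and such a drop is precisely a mark, lying in column
-- P(t) of the row below it.  Distinct rows have distinct prefix sums, so every pair of adjacent rows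
-- drops somewhere; by counting, every t < d carries exactly one mark, and the marks are met in reading
-- order as t increases.  If the t-th mark is in column b, rows above it have P(t) = b + 1 and rows
-- below it have P(t) = b.  So comp(A)_k = min_a (P_a(k) − P_a(k − 1)) is attained either at the
-- bottom row or at the row just above the mark for k − 1, which gives the three formulas.
module Submission where

open import Defs
open import Data.Nat using (ℕ; zero; suc; _+_; _≤_; _<_; _>_; _⊓_; _<?_; s≤s; z<s; s<s; s≤s⁻¹)
open import Data.Nat.Properties
open import Data.Nat.ListAction using (sum)
open import Data.Fin as Fin using (Fin; zero; suc; toℕ; inject₁; fromℕ; fromℕ<)
open import Data.Fin.Properties as Finₚ using (toℕ-inject₁; toℕ-fromℕ)
open import Data.Fin.Relation.Unary.Top using (view; ‵fromℕ; ‵inject₁)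
open import Data.List as List using (List; []; _∷_; _++_; replicate; concatMap; allFin; upTo; foldr)
open import Data.List.Relation.Unary.Any using (here; there)
open import Data.List.Relation.Unary.All as All using (All)
open import Data.List.Relation.Unary.AllPairs using (AllPairs; []; _∷_)
import Data.List.Relation.Unary.AllPairs.Properties as AllPairs
open import Data.List.Membership.Propositional using (_∈_; find; lose)
open import Data.List.Membership.Propositional.Properties
  using (∈-allFin; ∈-concatMap⁺; ∈-concatMap⁻; ∈-upTo⁺; ∈-upTo⁻; ∈-tabulate⁺; ∈-tabulate⁻)
open import Data.Product using (Σ; ∃; _×_; _,_; proj₁; proj₂)
open import Data.Product.Relation.Binary.Lex.Strict using (×-Lex; ×-asymmetric)
open import Data.Sum using (inj₁; inj₂)
open import Data.Bool using (if_then_else_)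
open import Data.Vec as Vec using (Vec; lookup; toList)
open import Data.Vec.Properties using (lookup∘tabulate)
open import Function using (_∘_; id)
open import Function.Definitions using (Injective)
open import Level using (Level)
open import Relation.Binary using (Rel; Asymmetric; tri<; tri≈; tri>)
open import Relation.Binary.PropositionalEquality
open import Relation.Nullary using (Dec; yes; no; does; ¬_; contradiction)
open import Algebra.Properties.CommutativeSemigroup +-commutativeSemigroup using (x∙yz≈y∙xz)
open ≤-Reasoning

multisetFrom : ∀ {n} → (Fin n → ℕ) → ℕ → List ℕ
multisetFrom {zero}  x b = []
multisetFrom {suc n} x b = replicate (x zero) b ++ multisetFrom (x ∘ suc) (suc b)

total : ∀ {n} → (Fin n → ℕ) → ℕ
total {zero}  x = 0
total {suc n} x = x zero + total (x ∘ suc)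

prefixSum : ∀ {n} → (Fin n → ℕ) → Fin n → ℕ
prefixSum x zero    = x zero
prefixSum x (suc t) = x zero + prefixSum (x ∘ suc) t

concatMap-replicate-tabulate : ∀ {m n} (x : Fin m → ℕ) (g : Fin n → Fin m) b →
  (∀ k → toℕ (g k) ≡ b + toℕ k) →
  concatMap (λ t → replicate (x t) (toℕ t)) (List.tabulate g) ≡ multisetFrom (x ∘ g) b
concatMap-replicate-tabulate {n = zero}  x g b g≗b+ = refl
concatMap-replicate-tabulate {n = suc n} x g b g≗b+ = cong₂ _++_
  (cong (replicate (x (g zero))) (trans (g≗b+ zero) (+-identityʳ b)))
  (concatMap-replicate-tabulate x (g ∘ suc) (suc b) (λ k → trans (g≗b+ (suc k)) (+-suc b (toℕ k))))

multiset≡multisetFrom : ∀ {d} (x : Pt d) → multiset x ≡ multisetFrom x 0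
multiset≡multisetFrom x = concatMap-replicate-tabulate x id 0 (λ _ → refl)

sum-map-tabulate : ∀ {m n} (x : Fin m → ℕ) (g : Fin n → Fin m) →
  sum (List.map x (List.tabulate g)) ≡ total (x ∘ g)
sum-map-tabulate {n = zero}  x g = refl
sum-map-tabulate {n = suc n} x g = cong (x (g zero) +_) (sum-map-tabulate x (g ∘ suc))

coordSum≡total : ∀ {d} (x : Pt d) → coordSum x ≡ total x
coordSum≡total x = sum-map-tabulate x id

nth-replicate-++ˡ : ∀ {c j} b l → j < c → nth (replicate c b ++ l) j ≡ b
nth-replicate-++ˡ {suc c} {zero}  b l _         = refl
nth-replicate-++ˡ {suc c} {suc j} b l (s<s j<c) = nth-replicate-++ˡ b l j<c

nth-replicate-++ʳ : ∀ c b l j → nth (replicate c b ++ l) (c + j) ≡ nth l j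
nth-replicate-++ʳ zero    b l j = refl
nth-replicate-++ʳ (suc c) b l j = nth-replicate-++ʳ c b l j

data Offset (c : ℕ) : ℕ → Set where
  inside : ∀ {j} → j < c → Offset c j
  beyond : ∀ j → Offset c (c + j)

offset : ∀ c j → Offset c j
offset zero    j       = beyond j
offset (suc c) zero    = inside z<s
offset (suc c) (suc j) with offset c j
... | inside j<c = inside (s<s j<c)
... | beyond k   = beyond k

x₀≤prefixSum : ∀ {n} (x : Fin (suc n) → ℕ) t → x zero ≤ prefixSum x t
x₀≤prefixSum x zero    = ≤-refl
x₀≤prefixSum x (suc t) = m≤m+n _ _

multisetFrom-≥ : ∀ {n} (x : Fin n → ℕ) b {j} → j < total x → b ≤ nth (multisetFrom x b) j
multisetFrom-≥ {suc n} x b {j} j<total with offset (x zero) j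
... | inside j<x₀ = ≤-reflexive (sym (nth-replicate-++ˡ b _ j<x₀))
... | beyond j rewrite nth-replicate-++ʳ (x zero) b (multisetFrom (x ∘ suc) (suc b)) j =
  ≤-trans (n≤1+n b) (multisetFrom-≥ (x ∘ suc) (suc b) (+-cancelˡ-< (x zero) _ _ j<total))

nth-multisetFrom-≤ : ∀ {n} (x : Fin n → ℕ) b {j} t →
  j < prefixSum x t → nth (multisetFrom x b) j ≤ b + toℕ t
nth-multisetFrom-≤ {suc n} x b {j} t j<P with offset (x zero) j
... | inside j<x₀ rewrite nth-replicate-++ˡ b (multisetFrom (x ∘ suc) (suc b)) j<x₀ = m≤m+n b (toℕ t)
nth-multisetFrom-≤ {suc n} x b zero    j<P | beyond j = contradiction j<P (m+n≮m _ _)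
nth-multisetFrom-≤ {suc n} x b (suc t) j<P | beyond j
  rewrite nth-replicate-++ʳ (x zero) b (multisetFrom (x ∘ suc) (suc b)) j | +-suc b (toℕ t) =
  nth-multisetFrom-≤ (x ∘ suc) (suc b) t (+-cancelˡ-< (x zero) _ _ j<P)

<-prefixSum : ∀ {n} (x : Fin n → ℕ) b {j} t →
  j < total x → nth (multisetFrom x b) j ≤ b + toℕ t → j < prefixSum x t
<-prefixSum {suc n} x b {j} t j<total nth≤ with offset (x zero) j
... | inside j<x₀ = <-≤-trans j<x₀ (x₀≤prefixSum x t)
<-prefixSum {suc n} x b zero    j<total nth≤ | beyond j = contradiction (begin
    suc b                                  ≤⟨ multisetFrom-≥ (x ∘ suc) (suc b) (+-cancelˡ-< (x zero) _ _ j<total) ⟩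
    nth (multisetFrom (x ∘ suc) (suc b)) j ≡⟨ nth-replicate-++ʳ (x zero) b _ j ⟨
    nth (multisetFrom x b) (x zero + j)    ≤⟨ nth≤ ⟩
    b + 0                                  ≡⟨ +-identityʳ b ⟩
    b                                      ∎) 1+n≰n
<-prefixSum {suc n} x b (suc t) j<total nth≤ | beyond j =
  +-monoʳ-< (x zero) (<-prefixSum (x ∘ suc) (suc b) t (+-cancelˡ-< (x zero) _ _ j<total)
    (subst₂ _≤_ (nth-replicate-++ʳ (x zero) b _ j) (+-suc b (toℕ t)) nth≤))

prefixSum-mono : ∀ {n} (x : Fin n → ℕ) {t t'} → t Fin.≤ t' → prefixSum x t ≤ prefixSum x t'
prefixSum-mono x {zero}  {zero}   _         = ≤-refl
prefixSum-mono x {zero}  {suc t'} _         = m≤m+n _ _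
prefixSum-mono x {suc t} {suc t'} (s≤s t≤t') = +-monoʳ-≤ (x zero) (prefixSum-mono (x ∘ suc) t≤t')

prefixSum-fromℕ : ∀ {n} (x : Fin (suc n) → ℕ) → prefixSum x (fromℕ n) ≡ total x
prefixSum-fromℕ {zero}  x = sym (+-identityʳ _)
prefixSum-fromℕ {suc n} x = cong (x zero +_) (prefixSum-fromℕ (x ∘ suc))

prefixSum-first : ∀ {n} (x : Fin n → ℕ) {t} → toℕ t ≡ 0 → prefixSum x t ≡ x t
prefixSum-first x {zero} _ = refl

prefixSum-step : ∀ {n} (x : Fin n → ℕ) {k k'} → toℕ k ≡ suc (toℕ k') →
  x k + prefixSum x k' ≡ prefixSum x k
prefixSum-step x {suc k} {zero}   k≡1     =
  trans (+-comm (x (suc k)) (x zero)) (cong (x zero +_) (sym (prefixSum-first (x ∘ suc) (suc-injective k≡1))))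
prefixSum-step x {suc k} {suc k'} k≡k'+1 =
  trans (x∙yz≈y∙xz (x (suc k)) (x zero) _) (cong (x zero +_) (prefixSum-step (x ∘ suc) (suc-injective k≡k'+1)))

prefixSum-injective : ∀ {n} (x y : Fin n → ℕ) → (∀ t → prefixSum x t ≡ prefixSum y t) → ∀ k → x k ≡ y k
prefixSum-injective x y P≡ zero    = P≡ zero
prefixSum-injective x y P≡ (suc k) = prefixSum-injective (x ∘ suc) (y ∘ suc)
  (λ t → +-cancelˡ-≡ (x zero) _ _ (trans (P≡ (suc t)) (cong (_+ prefixSum (y ∘ suc) t) (sym (P≡ zero))))) k

module _ {X : Set} (f : X → ℕ) where

  foldr-⊓-≤ : ∀ v {xs x} → x ∈ xs → foldr (λ y m → f y ⊓ m) v xs ≤ f x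
  foldr-⊓-≤ v (here refl) = m⊓n≤m _ _
  foldr-⊓-≤ v (there x∈xs) = ≤-trans (m⊓n≤n _ _) (foldr-⊓-≤ v x∈xs)

  foldr-⊓-glb : ∀ {c v} xs → c ≤ v → (∀ x → c ≤ f x) → c ≤ foldr (λ y m → f y ⊓ m) v xs
  foldr-⊓-glb []       c≤v c≤f = c≤v
  foldr-⊓-glb (x ∷ xs) c≤v c≤f = ⊓-glb (c≤f x) (foldr-⊓-glb xs c≤v c≤f)

comp-attained : ∀ {d} (A : Verts d) {k} a₀ → (∀ a → A a₀ k ≤ A a k) → comp A k ≡ A a₀ k
comp-attained {d} A {k} a₀ minimal = ≤-antisym
  (foldr-⊓-≤ (λ a → A a k) _ (∈-allFin a₀))
  (foldr-⊓-glb (λ a → A a k) (allFin (suc d)) (minimal zero) minimal)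

injective⇒surjective : ∀ {n} {f : Fin n → Fin n} → Injective _≡_ _≡_ f → ∀ t → ∃ λ i → f i ≡ t
injective⇒surjective {suc n} {f} f-injective t with Finₚ.any? (λ i → f i Finₚ.≟ t)
... | yes hit  = hit
... | no  miss = contradiction (Finₚ.injective⇒≤ punchOut∘f-injective) 1+n≰n
  where
  f≢t : ∀ i → t ≢ f i
  f≢t i t≡fi = miss (i , sym t≡fi)

  punchOut∘f-injective : Injective _≡_ _≡_ (λ i → Fin.punchOut (f≢t i))
  punchOut∘f-injective = f-injective ∘ Finₚ.punchOut-injective (f≢t _) (f≢t _)

_≺_ : ∀ {d} → Rel (ℕ × Fin d) _
_≺_ {d} = ×-Lex _≡_ _<_ (Fin._<_ {d} {d})

≺-asym : ∀ {d} → Asymmetric (_≺_ {d})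
≺-asym {d} = ×-asymmetric sym <-resp₂-≡ <-asym (λ {i} {j} → <-asym {toℕ i} {toℕ j})

module _ {X : Set} {ℓ : Level} {_⊏_ : Rel X ℓ} (⊏-asym : Asymmetric _⊏_) where

  private
    head-≡ : ∀ {x y xs ys} → All (x ⊏_) xs → All (y ⊏_) ys → x ∈ y ∷ ys → y ∈ x ∷ xs → x ≡ y
    head-≡ _    _    (here x≡y)   _            = x≡y
    head-≡ _    _    (there _)    (here y≡x)   = sym y≡x
    head-≡ x⊏xs y⊏ys (there x∈ys) (there y∈xs) =
      contradiction (All.lookup x⊏xs y∈xs) (⊏-asym (All.lookup y⊏ys x∈ys))

    drop-head : ∀ {x xs ys} → All (x ⊏_) xs → (∀ {z} → z ∈ xs → z ∈ x ∷ ys) → ∀ {z} → z ∈ xs → z ∈ ys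
    drop-head x⊏xs xs⊆ z∈xs with xs⊆ z∈xs
    ... | here refl  = contradiction (All.lookup x⊏xs z∈xs) λ x⊏x → ⊏-asym x⊏x x⊏x
    ... | there z∈ys = z∈ys

  sorted-unique : ∀ {xs ys} → AllPairs _⊏_ xs → AllPairs _⊏_ ys →
    (∀ {z} → z ∈ xs → z ∈ ys) → (∀ {z} → z ∈ ys → z ∈ xs) → xs ≡ ys
  sorted-unique {[]}     {[]}     _ _ _ _ = refl
  sorted-unique {[]}     {y ∷ ys} _ _ _ ys⊆ with () ← ys⊆ (here refl)
  sorted-unique {x ∷ xs} {[]}     _ _ xs⊆ _ with () ← xs⊆ (here refl)
  sorted-unique {x ∷ xs} {y ∷ ys} (x⊏xs ∷ xs↗) (y⊏ys ∷ ys↗) xs⊆ ys⊆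
    with refl ← head-≡ x⊏xs y⊏ys (xs⊆ (here refl)) (ys⊆ (here refl))
    = cong (x ∷_) (sorted-unique xs↗ ys↗ (drop-head x⊏xs (xs⊆ ∘ there)) (drop-head y⊏ys (ys⊆ ∘ there)))

AllPairs-concatMap⁺ : ∀ {X Y : Set} {ℓ ℓ'} {_⊏_ : Rel X ℓ} {_<_ : Rel Y ℓ'} (f : X → List Y) {xs} →
  AllPairs _⊏_ xs → (∀ x → AllPairs _<_ (f x)) →
  (∀ {x x'} → x ⊏ x' → ∀ {y y'} → y ∈ f x → y' ∈ f x' → y < y') → AllPairs _<_ (concatMap f xs)
AllPairs-concatMap⁺ f []           f↗ across = []
AllPairs-concatMap⁺ f (x⊏xs ∷ xs↗) f↗ across = AllPairs.++⁺ (f↗ _) (AllPairs-concatMap⁺ f xs↗ f↗ across)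
  (All.tabulate λ y∈ → All.tabulate λ y'∈ →
    let (x' , x'∈xs , y'∈fx') = find (∈-concatMap⁻ f y'∈) in across (All.lookup x⊏xs x'∈xs) y∈ y'∈fx')

module _ {X : Set} {P : Set} {w : X} where

  ∈-if⁻ : ∀ (P? : Dec P) {z} → z ∈ (if does P? then w ∷ [] else []) → P × z ≡ w
  ∈-if⁻ (yes p) (here z≡w) = p , z≡w

  ∈-if⁺ : ∀ (P? : Dec P) → P → w ∈ (if does P? then w ∷ [] else [])
  ∈-if⁺ (yes _)  _ = here refl
  ∈-if⁺ (no  ¬p) p = contradiction p ¬p

  AllPairs-if : ∀ (P? : Dec P) {ℓ} {R : Rel X ℓ} → AllPairs R (if does P? then w ∷ [] else [])
  AllPairs-if (yes _) = All.[] ∷ []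
  AllPairs-if (no  _) = []

IsMark : ∀ {d} → ℕ → Verts d → ℕ → Fin d → Set
IsMark r A j i = j < r × entry A (inject₁ i) j < entry A (suc i) j

module _ {d} (r : ℕ) (A : Verts d) where

  private
    marked? : ∀ j i → Dec (entry A (inject₁ i) j < entry A (suc i) j)
    marked? j i = entry A (inject₁ i) j <? entry A (suc i) j

    markAt : ℕ → Fin d → List (ℕ × Fin d)
    markAt j i = if does (marked? j i) then (j , i) ∷ [] else []

    marksIn : ℕ → List (ℕ × Fin d)
    marksIn j = concatMap (markAt j) (allFin d)

  ∈-marks⁻ : ∀ {j i} → (j , i) ∈ marks d r A → IsMark r A j i
  ∈-marks⁻ ji∈ with j' , j'∈ , ji∈ ← find (∈-concatMap⁻ marksIn {xs = upTo r} ji∈)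
               with i' , _   , ji∈ ← find (∈-concatMap⁻ (markAt j') {xs = allFin d} ji∈)
               with mark , refl ← ∈-if⁻ (marked? j' i') ji∈ = ∈-upTo⁻ j'∈ , mark

  ∈-marks⁺ : ∀ {j i} → IsMark r A j i → (j , i) ∈ marks d r A
  ∈-marks⁺ {j} {i} (j<r , mark) = ∈-concatMap⁺ marksIn (lose (∈-upTo⁺ j<r)
    (∈-concatMap⁺ (markAt j) (lose (∈-allFin i) (∈-if⁺ (marked? j i) mark))))

  marks-sorted : AllPairs _≺_ (marks d r A)
  marks-sorted = AllPairs-concatMap⁺ marksIn (AllPairs.applyUpTo⁺₁ id r (λ j<j' _ → j<j'))
    (λ j → AllPairs-concatMap⁺ (markAt j) (AllPairs.tabulate⁺-< id) (λ i → AllPairs-if (marked? j i)) same-column)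
    across-columns
    where
    same-column : ∀ {j i i'} → i Fin.< i' → ∀ {y y'} → y ∈ markAt j i → y' ∈ markAt j i' → y ≺ y'
    same-column {j} {i} {i'} i<i' y∈ y'∈
      with _ , refl ← ∈-if⁻ (marked? j i) y∈ | _ , refl ← ∈-if⁻ (marked? j i') y'∈ = inj₂ (refl , i<i')

    across-columns : ∀ {j j'} → j < j' → ∀ {y y'} → y ∈ marksIn j → y' ∈ marksIn j' → y ≺ y'
    across-columns {j} {j'} j<j' y∈ y'∈
      with i , _ , y∈  ← find (∈-concatMap⁻ (markAt j) {xs = allFin d} y∈)
         | i' , _ , y'∈ ← find (∈-concatMap⁻ (markAt j') {xs = allFin d} y'∈)
      with _ , refl ← ∈-if⁻ (marked? j i) y∈ | _ , refl ← ∈-if⁻ (marked? j' i') y'∈ = inj₁ j<j'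

i≤j⇒i≤inject₁[j] : ∀ {m n} {i : Fin m} {j : Fin n} → i Fin.≤ j → i Fin.≤ inject₁ j
i≤j⇒i≤inject₁[j] {j = j} = subst (_ ≤_) (sym (toℕ-inject₁ j))

i≤j⇒inject₁[i]≤j : ∀ {m n} {i : Fin m} {j : Fin n} → i Fin.≤ j → inject₁ i Fin.≤ j
i≤j⇒inject₁[i]≤j {i = i} = subst (_≤ _) (sym (toℕ-inject₁ i))

inject₁≤ : ∀ {n} (i : Fin n) → inject₁ i Fin.≤ i
inject₁≤ i = ≤-reflexive (toℕ-inject₁ i)

inject₁<suc : ∀ {n} (i : Fin n) → inject₁ i Fin.< suc i
inject₁<suc i = Finₚ.≤̄⇒inject₁< Finₚ.≤-refl

module DecoratedMatrix {d r : ℕ} (A : Verts d)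
  (onSimplex : ∀ a → coordSum (A a) ≡ r)
  (distinct : ∀ a a' → (∀ k → A a k ≡ A a' k) → a ≡ a')
  (sorted : Sorted d r A) where

  prefix : Fin (suc d) → Fin (suc d) → ℕ
  prefix a = prefixSum (A a)

  total≡r : ∀ a → total (A a) ≡ r
  total≡r a = trans (sym (coordSum≡total (A a))) (onSimplex a)

  prefix-fromℕ : ∀ a → prefix a (fromℕ d) ≡ r
  prefix-fromℕ a = trans (prefixSum-fromℕ (A a)) (total≡r a)

  prefix≤r : ∀ a t → prefix a t ≤ r
  prefix≤r a t = subst (prefix a t ≤_) (prefix-fromℕ a) (prefixSum-mono (A a) (Finₚ.≤fromℕ t))

  entry≡nth : ∀ a j → entry A a j ≡ nth (multisetFrom (A a) 0) j
  entry≡nth a j = cong (λ l → nth l j) (multiset≡multisetFrom (A a))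

  entry≤⇒<prefix : ∀ {a j} t → j < r → entry A a j ≤ toℕ t → j < prefix a t
  entry≤⇒<prefix {a} {j} t j<r entry≤t =
    <-prefixSum (A a) 0 t (subst (j <_) (sym (total≡r a)) j<r) (subst (_≤ toℕ t) (entry≡nth a j) entry≤t)

  <prefix⇒entry≤ : ∀ {a j} t → j < prefix a t → entry A a j ≤ toℕ t
  <prefix⇒entry≤ {a} {j} t j<prefix =
    subst (_≤ toℕ t) (sym (entry≡nth a j)) (nth-multisetFrom-≤ (A a) 0 t j<prefix)

  entry≤d : ∀ {a j} → j < r → entry A a j ≤ d
  entry≤d {a} {j} j<r =
    subst (entry A a j ≤_) (toℕ-fromℕ d) (<prefix⇒entry≤ (fromℕ d) (subst (j <_) (sym (prefix-fromℕ a)) j<r))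

  prefix-antitone : ∀ {a a'} t → a Fin.≤ a' → prefix a' t ≤ prefix a t
  prefix-antitone {a} {a'} t a≤a' = ≮⇒≥ λ j<prefix' →
    let j<r = <-≤-trans j<prefix' (prefix≤r a' t)
        entry≤t = ≤-trans (sorted a a' j j j<r (inj₂ (refl , a≤a'))) (<prefix⇒entry≤ t j<prefix')
    in n≮n j (entry≤⇒<prefix t j<r entry≤t)
    where j = prefix a t

  prefix≤suc : ∀ a a' t → prefix a t ≤ suc (prefix a' t)
  prefix≤suc a a' t = ≮⇒≥ λ j+1<prefix →
    let j+1<r = <-≤-trans j+1<prefix (prefix≤r a t)
        entry≤t = ≤-trans (sorted a' a j (suc j) j+1<r (inj₁ (n<1+n j))) (<prefix⇒entry≤ t j+1<prefix)
    in n≮n j (entry≤⇒<prefix t (<-trans (n<1+n j) j+1<r) entry≤t)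
    where j = prefix a' t

  prefix-≡ : ∀ {a a'} → (∀ t → prefix a (inject₁ t) ≡ prefix a' (inject₁ t)) → ∀ k → prefix a k ≡ prefix a' k
  prefix-≡ {a} {a'} inner≡ k with view k
  ... | ‵fromℕ     = trans (prefix-fromℕ a) (sym (prefix-fromℕ a'))
  ... | ‵inject₁ t = inner≡ t

  -- Row i has exactly one more entry ≤ t than row i + 1.
  Drop : Fin d → Fin d → Set
  Drop i t = prefix (inject₁ i) (inject₁ t) ≡ suc (prefix (suc i) (inject₁ t))

  adjacent-rows-differ : ∀ i → ¬ (∀ t → prefix (inject₁ i) (inject₁ t) ≡ prefix (suc i) (inject₁ t))
  adjacent-rows-differ i inner≡ = Finₚ.<⇒≢ (inject₁<suc i)
    (distinct _ _ (prefixSum-injective (A (inject₁ i)) (A (suc i)) (prefix-≡ inner≡)))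

  drop-exists : ∀ i → ∃ (Drop i)
  drop-exists i
    with t , prefix≢ ← Finₚ.¬∀⟶∃¬ d _ (λ t → prefix (inject₁ i) (inject₁ t) ≟ prefix (suc i) (inject₁ t))
                                      (adjacent-rows-differ i)
    = t , ≤-antisym (prefix≤suc (inject₁ i) (suc i) (inject₁ t))
                    (≤∧≢⇒< (prefix-antitone (inject₁ t) (<⇒≤ (inject₁<suc i))) (prefix≢ ∘ sym))

  no-lower-drop : ∀ {i i' t} → i Fin.< i' → Drop i t → ¬ Drop i' t
  no-lower-drop {i} {i'} {t} i<i' drop drop' = 1+n≰n (begin
    suc (suc (prefix (suc i') k)) ≡⟨ cong suc drop' ⟨
    suc (prefix (inject₁ i') k)   ≤⟨ s≤s (prefix-antitone k (i≤j⇒i≤inject₁[j] i<i')) ⟩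
    suc (prefix (suc i) k)        ≡⟨ drop ⟨
    prefix (inject₁ i) k          ≤⟨ prefix≤suc _ _ k ⟩
    suc (prefix (suc i') k)       ∎)
    where k = inject₁ t

  drop-unique : ∀ {i i' t} → Drop i t → Drop i' t → i ≡ i'
  drop-unique {i} {i'} {t} drop drop' with Finₚ.<-cmp i i'
  ... | tri< i<i' _ _ = contradiction drop' (no-lower-drop {t = t} i<i' drop)
  ... | tri≈ _ i≡i' _ = i≡i'
  ... | tri> _ _ i'<i = contradiction drop (no-lower-drop {t = t} i'<i drop')

  dropAt : Fin d → Fin d
  dropAt i = proj₁ (drop-exists i)

  dropAt-injective : Injective _≡_ _≡_ dropAt
  dropAt-injective {i} {i'} same =
    drop-unique {t = dropAt i'} (subst (Drop i) same (proj₂ (drop-exists i))) (proj₂ (drop-exists i'))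

  -- Opaque, so that unification never unfolds the pigeonhole search behind markRow.
  opaque
    markRow : Fin d → Fin d
    markRow t = proj₁ (injective⇒surjective dropAt-injective t)

    dropAt-markRow : ∀ t → dropAt (markRow t) ≡ t
    dropAt-markRow t = proj₂ (injective⇒surjective dropAt-injective t)

  drop-markRow : ∀ t → Drop (markRow t) t
  drop-markRow t = subst (Drop (markRow t)) (dropAt-markRow t) (proj₂ (drop-exists (markRow t)))

  markRow-injective : Injective _≡_ _≡_ markRow
  markRow-injective {t} {t'} same =
    trans (sym (dropAt-markRow t)) (trans (cong dropAt same) (dropAt-markRow t'))

  markCol : Fin d → ℕ
  markCol t = prefix (suc (markRow t)) (inject₁ t)

  prefix≤suc-markCol : ∀ a t → prefix a (inject₁ t) ≤ suc (markCol t)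
  prefix≤suc-markCol a t = prefix≤suc a (suc (markRow t)) (inject₁ t)

  markCol≤prefix : ∀ a t → markCol t ≤ prefix a (inject₁ t)
  markCol≤prefix a t =
    s≤s⁻¹ (subst (_≤ suc (prefix a (inject₁ t))) (drop-markRow t) (prefix≤suc (inject₁ (markRow t)) a (inject₁ t)))

  prefix-above : ∀ {a t} → a Fin.≤ markRow t → prefix a (inject₁ t) ≡ suc (markCol t)
  prefix-above {a} {t} a≤row = ≤-antisym (prefix≤suc-markCol a t)
    (subst (_≤ _) (drop-markRow t) (prefix-antitone (inject₁ t) (i≤j⇒i≤inject₁[j] a≤row)))

  prefix-below : ∀ {a t} → markRow t Fin.< a → prefix a (inject₁ t) ≡ markCol t
  prefix-below {a} {t} row<a = ≤-antisym (prefix-antitone (inject₁ t) row<a) (markCol≤prefix a t)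

  drop⇒mark : ∀ {i t} → Drop i t → IsMark r A (prefix (suc i) (inject₁ t)) i
  drop⇒mark {i} {t} drop = j<r , ≤-<-trans upper≤t t<lower
    where
    j = prefix (suc i) (inject₁ t)

    j<r : j < r
    j<r = subst (_≤ r) drop (prefix≤r (inject₁ i) (inject₁ t))

    upper≤t : entry A (inject₁ i) j ≤ toℕ t
    upper≤t = subst (entry A (inject₁ i) j ≤_) (toℕ-inject₁ t)
      (<prefix⇒entry≤ (inject₁ t) (subst (j <_) (sym drop) (n<1+n j)))

    t<lower : toℕ t < entry A (suc i) j
    t<lower = ≰⇒> λ lower≤t →
      n≮n j (entry≤⇒<prefix (inject₁ t) j<r (subst (entry A (suc i) j ≤_) (sym (toℕ-inject₁ t)) lower≤t))

  mark⇒drop : ∀ {j i} → IsMark r A j i → ∃ λ t → Drop i t × prefix (suc i) (inject₁ t) ≡ j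
  mark⇒drop {j} {i} (j<r , upper<lower) = t , drop , lower≡j
    where
    upper<d : entry A (inject₁ i) j < d
    upper<d = <-≤-trans upper<lower (entry≤d j<r)

    t : Fin d
    t = fromℕ< upper<d

    t≡upper : toℕ (inject₁ t) ≡ entry A (inject₁ i) j
    t≡upper = trans (toℕ-inject₁ t) (Finₚ.toℕ-fromℕ< upper<d)

    j<upper : j < prefix (inject₁ i) (inject₁ t)
    j<upper = entry≤⇒<prefix (inject₁ t) j<r (≤-reflexive (sym t≡upper))

    lower≤j : prefix (suc i) (inject₁ t) ≤ j
    lower≤j = ≮⇒≥ λ j<lower →
      <⇒≱ upper<lower (subst (entry A (suc i) j ≤_) t≡upper (<prefix⇒entry≤ (inject₁ t) j<lower))

    lower≡j : prefix (suc i) (inject₁ t) ≡ j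
    lower≡j = ≤-antisym lower≤j (s≤s⁻¹ (≤-trans j<upper (prefix≤suc (inject₁ i) (suc i) (inject₁ t))))

    drop : Drop i t
    drop = ≤-antisym (prefix≤suc (inject₁ i) (suc i) (inject₁ t))
      (subst (λ c → suc c ≤ prefix (inject₁ i) (inject₁ t)) (sym lower≡j) j<upper)

  markPos : Fin d → ℕ × Fin d
  markPos t = markCol t , markRow t

  isMark-markPos : ∀ t → IsMark r A (markCol t) (markRow t)
  isMark-markPos t = drop⇒mark {t = t} (drop-markRow t)

  isMark⇒markPos : ∀ {j i} → IsMark r A j i → ∃ λ t → (j , i) ≡ markPos t
  isMark⇒markPos mark with t , drop , refl ← mark⇒drop mark
                      with refl ← drop-unique {t = t} drop (drop-markRow t) = t , refl

  suc-markCol≤ : ∀ {t t'} → t Fin.≤ t' → suc (markCol t) ≤ prefix (inject₁ (markRow t)) (inject₁ t')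
  suc-markCol≤ {t} {t'} t≤t' = subst (_≤ prefix (inject₁ (markRow t)) (inject₁ t')) (drop-markRow t)
    (prefixSum-mono (A (inject₁ (markRow t))) (i≤j⇒inject₁[i]≤j (i≤j⇒i≤inject₁[j] t≤t')))

  markCol-mono : ∀ {t t'} → t Fin.≤ t' → markCol t ≤ markCol t'
  markCol-mono {t} {t'} t≤t' = s≤s⁻¹ (≤-trans (suc-markCol≤ t≤t') (prefix≤suc-markCol _ t'))

  markCol-< : ∀ {t t'} → t Fin.≤ t' → markRow t' Fin.< markRow t → markCol t < markCol t'
  markCol-< {t} {t'} t≤t' row'<row =
    ≤-trans (suc-markCol≤ t≤t') (≤-reflexive (prefix-below (i≤j⇒i≤inject₁[j] row'<row)))

  markPos-sorted : ∀ {t t'} → t Fin.< t' → markPos t ≺ markPos t'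
  markPos-sorted {t} {t'} t<t' with m≤n⇒m<n∨m≡n (markCol-mono (<⇒≤ t<t'))
  ... | inj₁ col<col' = inj₁ col<col'
  ... | inj₂ col≡col' with Finₚ.<-cmp (markRow t) (markRow t')
  ...   | tri< row<row' _ _ = inj₂ (col≡col' , row<row')
  ...   | tri≈ _ row≡row' _ = contradiction (markRow-injective row≡row') (Finₚ.<⇒≢ t<t')
  ...   | tri> _ _ row'<row = contradiction col≡col' (<⇒≢ (markCol-< (<⇒≤ t<t') row'<row))

  marks≡markPos : marks d r A ≡ List.tabulate markPos
  marks≡markPos = sorted-unique ≺-asym (marks-sorted r A) (AllPairs.tabulate⁺-< markPos-sorted) ⊆ ⊇
    where
    ⊆ : ∀ {z} → z ∈ marks d r A → z ∈ List.tabulate markPos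
    ⊆ z∈ = let t , z≡ = isMark⇒markPos (∈-marks⁻ r A z∈)
           in subst (_∈ List.tabulate markPos) (sym z≡) (∈-tabulate⁺ t)

    ⊇ : ∀ {z} → z ∈ List.tabulate markPos → z ∈ marks d r A
    ⊇ z∈ with t , refl ← ∈-tabulate⁻ z∈ = ∈-marks⁺ r A (isMark-markPos t)

  coord-first : ∀ a {t : Fin d} → toℕ t ≡ 0 → A a (inject₁ t) ≡ prefix a (inject₁ t)
  coord-first a {t} t≡0 = sym (prefixSum-first (A a) (trans (toℕ-inject₁ t) t≡0))

  coord-step : ∀ a {s t : Fin d} → toℕ t ≡ suc (toℕ s) →
    A a (inject₁ t) + prefix a (inject₁ s) ≡ prefix a (inject₁ t)
  coord-step a {s} {t} t≡s+1 =
    prefixSum-step (A a) (trans (toℕ-inject₁ t) (trans t≡s+1 (cong suc (sym (toℕ-inject₁ s)))))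

  coord-last : ∀ a {t : Fin d} → suc (toℕ t) ≡ d → A a (fromℕ d) + prefix a (inject₁ t) ≡ r
  coord-last a {t} t+1≡d = trans
    (prefixSum-step (A a) (trans (toℕ-fromℕ d) (trans (sym t+1≡d) (cong suc (sym (toℕ-inject₁ t))))))
    (prefix-fromℕ a)

  markRow<fromℕ : ∀ t → markRow t Fin.< fromℕ d
  markRow<fromℕ t = subst (toℕ (markRow t) <_) (sym (toℕ-fromℕ d)) (Finₚ.toℕ<n (markRow t))

  comp-first : ∀ t → toℕ t ≡ 0 → comp A (inject₁ t) ≡ markCol t
  comp-first t t≡0 = trans (comp-attained A (fromℕ d) minimal) bottom≡
    where
    bottom≡ : A (fromℕ d) (inject₁ t) ≡ markCol t
    bottom≡ = trans (coord-first (fromℕ d) t≡0) (prefix-below (markRow<fromℕ t))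

    minimal : ∀ a → A (fromℕ d) (inject₁ t) ≤ A a (inject₁ t)
    minimal a = begin
      A (fromℕ d) (inject₁ t) ≡⟨ bottom≡ ⟩
      markCol t               ≤⟨ markCol≤prefix a t ⟩
      prefix a (inject₁ t)    ≡⟨ coord-first a t≡0 ⟨
      A a (inject₁ t)         ∎

  comp-higher : ∀ {s t} → toℕ t ≡ suc (toℕ s) → markRow t Fin.< markRow s →
    comp A (inject₁ t) + 1 + markCol s ≡ markCol t
  comp-higher {s} {t} t≡s+1 higher = begin-equality
    comp A k + 1 + markCol s ≡⟨ cong (λ c → c + 1 + markCol s) (comp-attained A a₀ minimal) ⟩
    A a₀ k + 1 + markCol s   ≡⟨ +-assoc (A a₀ k) 1 (markCol s) ⟩
    A a₀ k + suc (markCol s) ≡⟨ a₀≡ ⟩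
    markCol t                ∎
    where
    k = inject₁ t
    a₀ = inject₁ (markRow s)

    a₀≡ : A a₀ k + suc (markCol s) ≡ markCol t
    a₀≡ = begin-equality
      A a₀ k + suc (markCol s)       ≡⟨ cong (A a₀ k +_) (prefix-above {t = s} (inject₁≤ (markRow s))) ⟨
      A a₀ k + prefix a₀ (inject₁ s) ≡⟨ coord-step a₀ t≡s+1 ⟩
      prefix a₀ k                    ≡⟨ prefix-below (i≤j⇒i≤inject₁[j] higher) ⟩
      markCol t                      ∎

    minimal : ∀ a → A a₀ k ≤ A a k
    minimal a = +-cancelʳ-≤ (prefix a (inject₁ s)) (A a₀ k) (A a k) (begin
      A a₀ k + prefix a (inject₁ s) ≤⟨ +-monoʳ-≤ (A a₀ k) (prefix≤suc-markCol a s) ⟩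
      A a₀ k + suc (markCol s)      ≡⟨ a₀≡ ⟩
      markCol t                     ≤⟨ markCol≤prefix a t ⟩
      prefix a k                    ≡⟨ coord-step a t≡s+1 ⟨
      A a k + prefix a (inject₁ s)  ∎)

  comp-lower : ∀ {s t} → toℕ t ≡ suc (toℕ s) → markRow s Fin.< markRow t →
    comp A (inject₁ t) + markCol s ≡ markCol t
  comp-lower {s} {t} t≡s+1 lower =
    trans (cong (_+ markCol s) (comp-attained A (fromℕ d) minimal)) bottom≡
    where
    k = inject₁ t

    bottom≡ : A (fromℕ d) k + markCol s ≡ markCol t
    bottom≡ = begin-equality
      A (fromℕ d) k + markCol s                    ≡⟨ cong (A (fromℕ d) k +_) (prefix-below (markRow<fromℕ s)) ⟨
      A (fromℕ d) k + prefix (fromℕ d) (inject₁ s) ≡⟨ coord-step (fromℕ d) t≡s+1 ⟩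
      prefix (fromℕ d) k                           ≡⟨ prefix-below (markRow<fromℕ t) ⟩
      markCol t                                    ∎

    bound : ∀ a → A (fromℕ d) k + prefix a (inject₁ s) ≤ prefix a k
    bound a with a Finₚ.≤? markRow s
    ... | yes above = ≤-reflexive (begin-equality
      A (fromℕ d) k + prefix a (inject₁ s)  ≡⟨ cong (A (fromℕ d) k +_) (prefix-above above) ⟩
      A (fromℕ d) k + suc (markCol s)       ≡⟨ +-suc (A (fromℕ d) k) (markCol s) ⟩
      suc (A (fromℕ d) k + markCol s)       ≡⟨ cong suc bottom≡ ⟩
      suc (markCol t)                       ≡⟨ prefix-above (≤-trans above (<⇒≤ lower)) ⟨
      prefix a k                            ∎)
    ... | no below = begin
      A (fromℕ d) k + prefix a (inject₁ s)  ≡⟨ cong (A (fromℕ d) k +_) (prefix-below (≰⇒> below)) ⟩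
      A (fromℕ d) k + markCol s             ≡⟨ bottom≡ ⟩
      markCol t                             ≤⟨ markCol≤prefix a t ⟩
      prefix a k                            ∎

    minimal : ∀ a → A (fromℕ d) k ≤ A a k
    minimal a = +-cancelʳ-≤ (prefix a (inject₁ s)) (A (fromℕ d) k) (A a k)
      (subst (A (fromℕ d) k + prefix a (inject₁ s) ≤_) (sym (coord-step a t≡s+1)) (bound a))

  comp-last : ∀ t → suc (toℕ t) ≡ d → comp A (fromℕ d) + markCol t + 1 ≡ r
  comp-last t t+1≡d = begin-equality
    comp A (fromℕ d) + markCol t + 1 ≡⟨ cong (λ c → c + markCol t + 1) (comp-attained A a₀ minimal) ⟩
    A a₀ (fromℕ d) + markCol t + 1   ≡⟨ +-assoc (A a₀ (fromℕ d)) (markCol t) 1 ⟩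
    A a₀ (fromℕ d) + (markCol t + 1) ≡⟨ cong (A a₀ (fromℕ d) +_) (+-comm (markCol t) 1) ⟩
    A a₀ (fromℕ d) + suc (markCol t) ≡⟨ a₀≡ ⟩
    r                                ∎
    where
    a₀ = inject₁ (markRow t)

    a₀≡ : A a₀ (fromℕ d) + suc (markCol t) ≡ r
    a₀≡ = begin-equality
      A a₀ (fromℕ d) + suc (markCol t)       ≡⟨ cong (A a₀ (fromℕ d) +_) (prefix-above {t = t} (inject₁≤ (markRow t))) ⟨
      A a₀ (fromℕ d) + prefix a₀ (inject₁ t) ≡⟨ coord-last a₀ t+1≡d ⟩
      r                                      ∎

    minimal : ∀ a → A a₀ (fromℕ d) ≤ A a (fromℕ d)
    minimal a = +-cancelʳ-≤ (prefix a (inject₁ t)) (A a₀ (fromℕ d)) (A a (fromℕ d)) (begin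
      A a₀ (fromℕ d) + prefix a (inject₁ t) ≤⟨ +-monoʳ-≤ (A a₀ (fromℕ d)) (prefix≤suc-markCol a t) ⟩
      A a₀ (fromℕ d) + suc (markCol t)      ≡⟨ a₀≡ ⟩
      r                                     ≡⟨ coord-last a t+1≡d ⟨
      A a (fromℕ d) + prefix a (inject₁ t)  ∎)

toList-tabulate : ∀ {X : Set} {n} (f : Fin n → X) → toList (Vec.tabulate f) ≡ List.tabulate f
toList-tabulate {n = zero}  f = refl
toList-tabulate {n = suc n} f = cong (f zero ∷_) (toList-tabulate (f ∘ suc))

lemma3p10 : (d r : ℕ) → 1 ≤ d → 1 ≤ r → (A : Verts d) →
    IsAlcove d r A → Sorted d r A →
    Σ (Vec (ℕ × Fin d) d) λ ms →
      toList ms ≡ marks d r A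
      × (∀ (t : Fin d) → toℕ t ≡ 0 →
           comp A (inject₁ t) ≡ proj₁ (lookup ms t))
      × (∀ (s t : Fin d) → toℕ t ≡ suc (toℕ s) →
           toℕ (proj₂ (lookup ms t)) < toℕ (proj₂ (lookup ms s)) →
           comp A (inject₁ t) + 1 + proj₁ (lookup ms s) ≡ proj₁ (lookup ms t))
      × (∀ (s t : Fin d) → toℕ t ≡ suc (toℕ s) →
           toℕ (proj₂ (lookup ms t)) > toℕ (proj₂ (lookup ms s)) →
           comp A (inject₁ t) + proj₁ (lookup ms s) ≡ proj₁ (lookup ms t))
      × (∀ (t : Fin d) → suc (toℕ t) ≡ d →
           comp A (fromℕ d) + proj₁ (lookup ms t) + 1 ≡ r)
lemma3p10 d r _ _ A isAlcove sorted =
  ms , trans (toList-tabulate markPos) (sym marks≡markPos) , first , higher , lower , last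
  where
  open IsAlcove isAlcove using (onSimplex; distinct)
  open DecoratedMatrix A onSimplex distinct sorted

  ms : Vec (ℕ × Fin d) d
  ms = Vec.tabulate markPos

  first : ∀ t → toℕ t ≡ 0 → comp A (inject₁ t) ≡ proj₁ (lookup ms t)
  first t rewrite lookup∘tabulate markPos t = comp-first t

  higher : ∀ s t → toℕ t ≡ suc (toℕ s) → toℕ (proj₂ (lookup ms t)) < toℕ (proj₂ (lookup ms s)) →
    comp A (inject₁ t) + 1 + proj₁ (lookup ms s) ≡ proj₁ (lookup ms t)
  higher s t rewrite lookup∘tabulate markPos s | lookup∘tabulate markPos t = comp-higher

  lower : ∀ s t → toℕ t ≡ suc (toℕ s) → toℕ (proj₂ (lookup ms t)) > toℕ (proj₂ (lookup ms s)) →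
    comp A (inject₁ t) + proj₁ (lookup ms s) ≡ proj₁ (lookup ms t)
  lower s t rewrite lookup∘tabulate markPos s | lookup∘tabulate markPos t = comp-lower

  last : ∀ t → suc (toℕ t) ≡ d → comp A (fromℕ d) + proj₁ (lookup ms t) + 1 ≡ r
  last t rewrite lookup∘tabulate markPos t = comp-last t
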